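{- Let $(\mathsf P,\mathcal O)$ be a semitopology. Then every topen $T$ is contained in a unique maximal topen.
   Context: A semitopology $(\mathsf P,\mathcal O)$: a set $\mathsf P$ with a family $\mathcal O\subseteq\mathcal P(\mathsf P)$ of open sets containing $\varnothing$ and $\mathsf P$ and closed under arbitrary unions (not necessarily under intersections). Write $X\between Y$ for $X\cap Y\neq\varnothing$. $T\subseteq\mathsf P$ is transitive when for all $O,O'\in\mathcal O$, $O\between T$ and $T\between O'$ imply $O\between O'$. A topen is a nonempty open transitive set. A maximal topen is a topen not strictly contained in any other topen. -}

module Defs where

open import Level using (0ℓ)
open import Data.Product using (Σ; ∃; _×_; _,_)
open import Relation.Unary using (Pred; _∈_; _⊆_; ∅; U)

_≐_ : {P : Set} → Pred P 0ℓ → Pred P 0ℓ → Set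
X ≐ Y = (X ⊆ Y) × (Y ⊆ X)

_≬_ : {P : Set} → Pred P 0ℓ → Pred P 0ℓ → Set
X ≬ Y = ∃ λ x → x ∈ X × x ∈ Y

-- A semitopology: a set of points with a (small) family of open sets,
-- presented as an index type Idx with each index naming an open set ⟦ i ⟧.
-- Closure under intersection is NOT required.
record Semitopology : Set₁ where
  field
    Point : Set
    Idx   : Set
    ⟦_⟧   : Idx → Pred Point 0ℓ
    open-∅ : ∃ λ i → ⟦ i ⟧ ≐ ∅
    open-P : ∃ λ i → ⟦ i ⟧ ≐ U
    open-⋃ : (I : Set) (f : I → Idx) →
             ∃ λ j → ⟦ j ⟧ ≐ (λ x → ∃ λ k → x ∈ ⟦ f k ⟧)

  IsOpen : Pred Point 0ℓ → Set
  IsOpen X = ∃ λ i → ⟦ i ⟧ ≐ X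

  Transitive : Pred Point 0ℓ → Set
  Transitive T = (i j : Idx) → ⟦ i ⟧ ≬ T → T ≬ ⟦ j ⟧ → ⟦ i ⟧ ≬ ⟦ j ⟧

  Topen : Pred Point 0ℓ → Set
  Topen T = (∃ λ x → x ∈ T) × IsOpen T × Transitive T

  MaxTopen : Pred Point 0ℓ → Set₁
  MaxTopen M = Topen M × ((T' : Pred Point 0ℓ) → Topen T' → M ⊆ T' → T' ⊆ M)

-- Fix an open transitive set ⟦ t ⟧ and take the union C of all open
-- transitive sets meeting it. C is open, and it is transitive: if O meets
-- ⟦ a ⟧ ⊆ C and O' meets ⟦ b ⟧ ⊆ C, then transitivity of ⟦ a ⟧, ⟦ t ⟧ and
-- ⟦ b ⟧ in turn gives O ≬ ⟦ t ⟧, O ≬ ⟦ b ⟧ and O ≬ O'. Every topen meeting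
-- ⟦ t ⟧ lies inside C, so C is the largest topen containing ⟦ t ⟧ and every
-- maximal topen meeting ⟦ t ⟧ coincides with it.
module Submission where

open import Defs
open import Level using (0ℓ)
open import Data.Product using (Σ; ∃; _×_; _,_; proj₁; proj₂)
open import Relation.Unary using (Pred; _∈_; _⊆_)
open import Relation.Unary.Properties using (≬-sym)

module _ {P : Set} {X Y Z : Pred P 0ℓ} where

  ≬-monoˡ : X ⊆ Y → X ≬ Z → Y ≬ Z
  ≬-monoˡ X⊆Y (x , x∈X , x∈Z) = x , X⊆Y x∈X , x∈Z

  ≬-monoʳ : Y ⊆ Z → X ≬ Y → X ≬ Z
  ≬-monoʳ Y⊆Z (x , x∈X , x∈Y) = x , x∈X , Y⊆Z x∈Y

module _ (S : Semitopology) where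
  open Semitopology S

  transitive-⊆ : {X Y : Pred Point 0ℓ} → X ⊆ Y → Transitive Y → Transitive X
  transitive-⊆ X⊆Y tY i j i≬X X≬j = tY i j (≬-monoʳ X⊆Y i≬X) (≬-monoˡ X⊆Y X≬j)

  topen-≐ : {X Y : Pred Point 0ℓ} → X ≐ Y → Topen X → Topen Y
  topen-≐ (X⊆Y , Y⊆X) ((x , x∈X) , (i , i⊆X , X⊆i) , tX) =
    (x , X⊆Y x∈X) , (i , (λ x∈i → X⊆Y (i⊆X x∈i)) , (λ x∈Y → X⊆i (Y⊆X x∈Y)))
    , transitive-⊆ Y⊆X tX

  component : Idx → Pred Point 0ℓ
  component t x = ∃ λ i → (Transitive ⟦ i ⟧ × ⟦ t ⟧ ≬ ⟦ i ⟧) × x ∈ ⟦ i ⟧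

  component-open : (t : Idx) → IsOpen (component t)
  component-open t with open-⋃ (Σ Idx λ i → Transitive ⟦ i ⟧ × ⟦ t ⟧ ≬ ⟦ i ⟧) proj₁
  ... | j , ⋃⊆C , C⊆⋃ =
    j , (λ { x∈j → let ((i , good) , x∈i) = ⋃⊆C x∈j in i , good , x∈i })
      , (λ { (i , good , x∈i) → C⊆⋃ ((i , good) , x∈i) })

  component-transitive : (t : Idx) → Transitive ⟦ t ⟧ → Transitive (component t)
  component-transitive t tt o o′ (_ , x∈o , a , (ta , t≬a) , x∈a)
                                 (y , (b , (tb , t≬b) , y∈b) , y∈o′) =
    tb o o′ o≬b (y , y∈b , y∈o′)
    where
      o≬t : ⟦ o ⟧ ≬ ⟦ t ⟧
      o≬t = ta o t (_ , x∈o , x∈a) (≬-sym t≬a)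

      o≬b : ⟦ o ⟧ ≬ ⟦ b ⟧
      o≬b = tt o b o≬t t≬b

  ⊆-component : (t : Idx) → Transitive ⟦ t ⟧ → ⟦ t ⟧ ⊆ component t
  ⊆-component t tt x∈t = t , (tt , (_ , x∈t , x∈t)) , x∈t

  topen⊆component : (t : Idx) {X : Pred Point 0ℓ} → Topen X → ⟦ t ⟧ ≬ X →
                    X ⊆ component t
  topen⊆component t (_ , (k , k⊆X , X⊆k) , tX) t≬X x∈X =
    k , (transitive-⊆ k⊆X tX , ≬-monoʳ X⊆k t≬X) , X⊆k x∈X

  component-maxTopen : (t : Idx) → Topen ⟦ t ⟧ → MaxTopen (component t)
  component-maxTopen t ((x , x∈t) , _ , tt) =
    ((x , ⊆-component t tt x∈t) , component-open t , component-transitive t tt)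
    , λ X topenX C⊆X →
        topen⊆component t topenX (x , x∈t , C⊆X (⊆-component t tt x∈t))

  maxTopen≐component : (t : Idx) {M : Pred Point 0ℓ} → Topen ⟦ t ⟧ →
                       MaxTopen M → ⟦ t ⟧ ≬ M → M ≐ component t
  maxTopen≐component t {M} topenT (topenM , maxM) t≬M =
    M⊆C , maxM (component t) (proj₁ (component-maxTopen t topenT)) M⊆C
    where
      M⊆C : M ⊆ component t
      M⊆C = topen⊆component t topenM t≬M

corollary3p21 : (S : Semitopology) → let open Semitopology S in
    (T : Pred Point 0ℓ) → Topen T →
    Σ (Pred Point 0ℓ) λ M → MaxTopen M × T ⊆ M ×
    ((M' : Pred Point 0ℓ) → MaxTopen M' → T ⊆ M' → M' ≐ M)
corollary3p21 S T topenT@((x , x∈T) , (t , t⊆T , T⊆t) , _) =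
  component S t , component-maxTopen S t topen-t , T⊆C ,
  λ M′ maxM′ T⊆M′ → maxTopen≐component S t topen-t maxM′ (x , T⊆t x∈T , T⊆M′ x∈T)
  where
    open Semitopology S

    topen-t : Topen ⟦ t ⟧
    topen-t = topen-≐ S (T⊆t , t⊆T) topenT

    T⊆C : T ⊆ component S t
    T⊆C x∈T′ = ⊆-component S t (proj₂ (proj₂ topen-t)) (T⊆t x∈T′)
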